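{- Let $H=(V,E)$ and $H'=(V',E')$ be $d$-uniform hypergraphs with $d\ge 3$ such that $\mathrm{Z}_0(H')=1$. Then $\mathrm{Z}_0(H\,\Box\, H')=\mathrm{Z}_0(H)$.
   Context: For a set $S$ and an object $v$, $S\times v=\{(x,v):x\in S\}$ and $v\times S=\{(v,x):x\in S\}$. The Cartesian product $H\Box H'$ is the $d$-hypergraph with vertex set $V\times V'$ and edge set $\{e\times v': e\in E, v'\in V'\}\cup\{v\times e': v\in V, e'\in E'\}$. $\mathrm{Z}_0$ of a $d$-hypergraph: with a set $B$ initially blue and the others white, a set $S$ of $d-1$ distinct vertices (not necessarily blue) can turn a white vertex $w$ blue if $S\cup\{w\}$ is an edge and every white $u$ such that $S\cup\{u\}$ is an edge equals $w$. $B$ is a zero forcing set if repeated application colors all vertices blue; $\mathrm{Z}_0$ is the minimum cardinality of a zero forcing set. -}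

module Defs where

open import Data.Nat using (ℕ; _≤_; _∸_)
open import Data.Fin using (Fin; combine)
open import Data.Fin.Subset using (Subset; _∪_; ⁅_⁆; ∣_∣; _∈_; _∉_; ⊤)
open import Data.Product using (Σ; ∃; _×_; _,_)
open import Data.Sum using (_⊎_)
open import Function.Bundles using (_⇔_)
open import Relation.Binary.PropositionalEquality using (_≡_)

record Hypergraph : Set₁ where
  field
    n : ℕ
    E : Subset n → Set
open Hypergraph public

Uniform : ℕ → Hypergraph → Set
Uniform d H = ∀ (e : Subset (n H)) → E H e → ∣ e ∣ ≡ d

-- Vertex (i , j) ∈ V × V' is encoded as
-- combine i j : Fin (n * n') (a bijection Fin n × Fin n' ≅ Fin (n * n')).
_□_ : Hypergraph → Hypergraph → Hypergraph
H □ H' = record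
  { n = n H Data.Nat.* n H'
  ; E = λ s →
      (Σ (Subset (n H)) λ e → Σ (Fin (n H')) λ v' → E H e ×
          (∀ i j → (combine i j ∈ s) ⇔ ((i ∈ e) × (j ≡ v'))))
    ⊎ (Σ (Fin (n H)) λ v → Σ (Subset (n H')) λ e' → E H' e' ×
          (∀ i j → (combine i j ∈ s) ⇔ ((i ≡ v) × (j ∈ e'))))
  }

Forces : (d : ℕ) (H : Hypergraph) → Subset (n H) → Subset (n H) → Fin (n H) → Set
Forces d H B S w =
  (∣ S ∣ ≡ d ∸ 1) × (w ∉ B) × E H (S ∪ ⁅ w ⁆) ×
  (∀ u → u ∉ B → E H (S ∪ ⁅ u ⁆) → u ≡ w)

data Reaches (d : ℕ) (H : Hypergraph) : Subset (n H) → Subset (n H) → Set where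
  done : ∀ {B} → Reaches d H B B
  step : ∀ {B C} S w → Forces d H B S w → Reaches d H (B ∪ ⁅ w ⁆) C → Reaches d H B C

ZeroForcingSet : (d : ℕ) (H : Hypergraph) → Subset (n H) → Set
ZeroForcingSet d H B = Reaches d H B ⊤

IsZ₀ : (d : ℕ) (H : Hypergraph) → ℕ → Set
IsZ₀ d H k =
  (Σ (Subset (n H)) λ B → ZeroForcingSet d H B × ∣ B ∣ ≡ k) ×
  (∀ B → ZeroForcingSet d H B → k ≤ ∣ B ∣)

-- Upper bound: if B and B′ are zero forcing sets of H and H′, then B × B′ is one of H □ H′.
-- Each layer V × {v} with v ∈ B′ is a copy of H and is forced by replaying the forces of B;
-- afterwards every fiber {x} × V′ contains B′ and is forced by replaying the forces of B′.
-- Lower bound: if B forces H □ H′, its projection D onto V has ∣ D ∣ ≤ ∣ B ∣, and D forces H.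
-- Otherwise the forcing process from D stalls at some C ≠ V, and since Z₀(H′) = 1 the empty set
-- stalls in H′ at some A ≠ V′. Then C × V′ ∪ V × A is stalled in H □ H′ and contains B, yet
-- misses every (x , y) with x ∉ C and y ∉ A, so B cannot force H □ H′.
-- Both directions rest on d ≥ 3: an edge of H □ H′ through d − 1 ≥ 2 vertices of a layer lies
-- in that layer, so the forces inside a layer are exactly the forces of H (likewise for fibers).
module Submission where

open import Defs
open import Data.Bool using (true; false; if_then_else_; _∧_; _∨_)
open import Data.Bool.Properties using (∧-distribʳ-∨; ∧-distribˡ-∨)
open import Data.Empty using (⊥; ⊥-elim)
open import Data.Fin using (Fin; zero; suc; combine; remQuot; _↑ˡ_; _↑ʳ_)
open import Data.Fin.Properties using (combine-remQuot; combine-injectiveˡ; combine-injectiveʳ; ¬∀⟶∃¬)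
open import Data.Fin.Subset
  using (Subset; inside; outside; ∣_∣; _∈_; _∉_; _⊆_; _∪_; ⁅_⁆; ⊤; Nonempty) renaming (⊥ to ∅)
open import Data.Fin.Subset.Properties
  using (_∈?_; ⊆-refl; ⊆-trans; ⊆-antisym; ⊆⊤; ∈⊤; p⊆p∪q; x∈p∪q⁺; x∈p∪q⁻; x∈⁅x⁆; x∈⁅y⁆⇒x≡y;
         Empty-unique; ∣⊥∣≡0; ∣⁅x⁆∣≡1; ∣p∣≤n; p⊆q⇒∣p∣≤∣q∣; p⊂q⇒∣p∣<∣q∣; nonempty?)
open import Data.List using (List; []; _∷_; allFin)
open import Data.List.Membership.Propositional using () renaming (_∈_ to _∈ₗ_)
open import Data.List.Membership.Propositional.Properties using (∈-allFin)
open import Data.List.Relation.Unary.Any using (here; there)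
open import Data.Nat using (ℕ; zero; suc; _+_; _*_; _∸_; _≤_; _<_; _≤?_; z≤n; s≤s)
open import Data.Nat.Properties
  using (module ≤-Reasoning; +-monoˡ-≤; +-monoʳ-≤; +-suc; +-identityʳ; *-identityʳ; ∸-monoˡ-≤;
         ≤-trans; ≤-<-trans; <⇒≱; <⇒≢; 1+n≰n; m≤m+n; m≤n+m)
open import Data.Product using (∃; ∃₂; _×_; _,_; proj₁; proj₂)
import Data.Product
open import Data.Sum using (_⊎_; inj₁; inj₂; [_,_])
import Data.Sum
open import Data.Vec using ([]; _∷_; _++_; lookup; tabulate; take; drop; here; there)
open import Data.Vec.Properties
  using (lookup-++ˡ; lookup-++ʳ; lookup-zipWith; lookup-replicate; lookup∘tabulate; take++drop≡id;
         []=⇒lookup; lookup⇒[]=)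
open import Function using (_∘_; id; case_of_)
open import Function.Bundles using (_⇔_; mk⇔; Equivalence)
open import Relation.Binary.PropositionalEquality hiding ([_])
open import Relation.Nullary using (¬_; does; yes; no)
open import Relation.Nullary.Decidable using (decidable-stable)

open Equivalence using (to; from)

∈⇔lookup : ∀ {a} {p : Subset a} {x} → x ∈ p ⇔ lookup p x ≡ inside
∈⇔lookup = mk⇔ []=⇒lookup (lookup⇒[]= _ _)

preimage : ∀ {a c} → (Fin a → Fin c) → Subset c → Subset a
preimage f s = tabulate (λ i → lookup s (f i))

∈-preimage : ∀ {a c} (f : Fin a → Fin c) (s : Subset c) i → i ∈ preimage f s ⇔ f i ∈ s
∈-preimage f s i = mk⇔
  (λ i∈ → from ∈⇔lookup (trans (sym (lookup∘tabulate (lookup s ∘ f) i)) (to ∈⇔lookup i∈)))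
  (λ fi∈ → from ∈⇔lookup (trans (lookup∘tabulate (lookup s ∘ f) i) (to ∈⇔lookup fi∈)))

0<∣p∣⇒Nonempty : ∀ {a} {p : Subset a} → 0 < ∣ p ∣ → Nonempty p
0<∣p∣⇒Nonempty {a} {p} 0<∣p∣ with nonempty? p
... | yes p≢∅ = p≢∅
... | no  p≡∅ = ⊥-elim (<⇒≢ 0<∣p∣ (sym (trans (cong ∣_∣ (Empty-unique p≡∅)) (∣⊥∣≡0 a))))

Nonempty⇒0<∣p∣ : ∀ {a} {p : Subset a} → Nonempty p → 0 < ∣ p ∣
Nonempty⇒0<∣p∣ {p = p} (x , x∈p) = subst (_≤ ∣ p ∣) (∣⁅x⁆∣≡1 x) (p⊆q⇒∣p∣≤∣q∣ ⁅x⁆⊆p)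
  where
  ⁅x⁆⊆p : ⁅ x ⁆ ⊆ p
  ⁅x⁆⊆p y∈⁅x⁆ rewrite x∈⁅y⁆⇒x≡y x y∈⁅x⁆ = x∈p

x∈p∪⁅y⁆⁻ : ∀ {a} {p : Subset a} {x y} → x ∈ p ∪ ⁅ y ⁆ → x ∈ p ⊎ x ≡ y
x∈p∪⁅y⁆⁻ {p = p} {y = y} x∈ with x∈p∪q⁻ p ⁅ y ⁆ x∈
... | inj₁ x∈p = inj₁ x∈p
... | inj₂ x∈y = inj₂ (x∈⁅y⁆⇒x≡y y x∈y)

x∈p∪⁅y⁆⁺ : ∀ {a} {p : Subset a} {x y} → x ∈ p ⊎ x ≡ y → x ∈ p ∪ ⁅ y ⁆
x∈p∪⁅y⁆⁺ (inj₁ x∈p)  = x∈p∪q⁺ (inj₁ x∈p)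
x∈p∪⁅y⁆⁺ (inj₂ refl) = x∈p∪q⁺ (inj₂ (x∈⁅x⁆ _))

p⊆⁅x⁆⇒∣p∣≤1 : ∀ {a} {p : Subset a} {x} → p ⊆ ⁅ x ⁆ → ∣ p ∣ ≤ 1
p⊆⁅x⁆⇒∣p∣≤1 {p = p} {x} p⊆⁅x⁆ = subst (∣ p ∣ ≤_) (∣⁅x⁆∣≡1 x) (p⊆q⇒∣p∣≤∣q∣ p⊆⁅x⁆)

p∪q≡r⇒p⊆r : ∀ {a} {p q r : Subset a} → p ∪ q ≡ r → p ⊆ r
p∪q≡r⇒p⊆r {q = q} refl = p⊆p∪q q

∣p∣<∣p∪⁅x⁆∣ : ∀ {a} {p : Subset a} {x} → x ∉ p → ∣ p ∣ < ∣ p ∪ ⁅ x ⁆ ∣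
∣p∣<∣p∪⁅x⁆∣ {p = p} {x} x∉p = p⊂q⇒∣p∣<∣q∣ (p⊆p∪q ⁅ x ⁆ , x , x∈p∪⁅y⁆⁺ (inj₂ refl) , x∉p)

-- The set p × q under the encoding (i , j) ↦ combine i j of V × V′.
_⊗_ : ∀ {a b} → Subset a → Subset b → Subset (a * b)
[]      ⊗ q = []
(x ∷ p) ⊗ q = (if x then q else ∅) ++ p ⊗ q

∣++∣ : ∀ {a b} (p : Subset a) (q : Subset b) → ∣ p ++ q ∣ ≡ ∣ p ∣ + ∣ q ∣
∣++∣ []            q = refl
∣++∣ (inside  ∷ p) q = cong suc (∣++∣ p q)
∣++∣ (outside ∷ p) q = ∣++∣ p q

∣⊗∣ : ∀ {a b} (p : Subset a) (q : Subset b) → ∣ p ⊗ q ∣ ≡ ∣ p ∣ * ∣ q ∣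
∣⊗∣ []            q = refl
∣⊗∣ (inside  ∷ p) q = trans (∣++∣ q (p ⊗ q)) (cong (∣ q ∣ +_) (∣⊗∣ p q))
∣⊗∣ {b = b} (outside ∷ p) q = trans (∣++∣ (∅ {b}) (p ⊗ q)) (cong₂ _+_ (∣⊥∣≡0 b) (∣⊗∣ p q))

lookup-⊗ : ∀ {a b} (p : Subset a) (q : Subset b) i j →
           lookup (p ⊗ q) (combine i j) ≡ lookup p i ∧ lookup q j
lookup-⊗ (true  ∷ p) q zero    j = lookup-++ˡ q (p ⊗ q) j
lookup-⊗ (false ∷ p) q zero    j = trans (lookup-++ˡ ∅ (p ⊗ q) j) (lookup-replicate j false)
lookup-⊗ (x     ∷ p) q (suc i) j =
  trans (lookup-++ʳ (if x then q else ∅) (p ⊗ q) (combine i j)) (lookup-⊗ p q i j)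

-- Fixing the factor sizes lets Agda infer arguments that the product a * b does not determine.
module Grid (a b : ℕ) where

  ∈-⊗⁺ : ∀ {p : Subset a} {q : Subset b} {i j} → i ∈ p → j ∈ q → combine i j ∈ p ⊗ q
  ∈-⊗⁺ {p} {q} {i} {j} i∈p j∈q = from ∈⇔lookup
    (trans (lookup-⊗ p q i j) (cong₂ _∧_ (to ∈⇔lookup i∈p) (to ∈⇔lookup j∈q)))

  ∈-⊗⁻ : ∀ (p : Subset a) (q : Subset b) i j → combine i j ∈ p ⊗ q → i ∈ p × j ∈ q
  ∈-⊗⁻ p q i j c∈ with split (trans (sym (lookup-⊗ p q i j)) (to ∈⇔lookup c∈))
    where
    split : ∀ {x y} → x ∧ y ≡ true → x ≡ true × y ≡ true
    split {true} {true} _ = refl , refl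
  ... | pᵢ , qⱼ = from ∈⇔lookup pᵢ , from ∈⇔lookup qⱼ

  combine-surjective : (c : Fin (a * b)) → ∃₂ λ i j → combine i j ≡ c
  combine-surjective c = proj₁ (remQuot {a} b c) , proj₂ (remQuot {a} b c) , combine-remQuot {a} b c

  ⊆-combine : ∀ {s t : Subset (a * b)} → (∀ i j → combine i j ∈ s → combine i j ∈ t) → s ⊆ t
  ⊆-combine h {c} c∈s with combine-surjective c
  ... | i , j , refl = h i j c∈s

  ≡-combine : ∀ {s t : Subset (a * b)} → (∀ i j → combine i j ∈ s ⇔ combine i j ∈ t) → s ≡ t
  ≡-combine h = ⊆-antisym (⊆-combine (λ i j → to (h i j))) (⊆-combine (λ i j → from (h i j)))

  ⁅⁆⊗⁅⁆ : ∀ x y → ⁅ x ⁆ ⊗ ⁅ y ⁆ ≡ ⁅ combine x y ⁆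
  ⁅⁆⊗⁅⁆ x y = ≡-combine λ i j → mk⇔ (⇒ i j) (⇐ i j)
    where
    ⇒ : ∀ (i : Fin a) (j : Fin b) → combine i j ∈ ⁅ x ⁆ ⊗ ⁅ y ⁆ → combine i j ∈ ⁅ combine x y ⁆
    ⇒ i j c∈ with ∈-⊗⁻ ⁅ x ⁆ ⁅ y ⁆ i j c∈
    ... | i∈ , j∈ rewrite x∈⁅y⁆⇒x≡y x i∈ | x∈⁅y⁆⇒x≡y y j∈ = x∈⁅x⁆ (combine x y)
    ⇐ : ∀ (i : Fin a) (j : Fin b) → combine i j ∈ ⁅ combine x y ⁆ → combine i j ∈ ⁅ x ⁆ ⊗ ⁅ y ⁆
    ⇐ i j c∈ with eq ← x∈⁅y⁆⇒x≡y (combine x y) c∈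
      rewrite combine-injectiveˡ i j x y eq | combine-injectiveʳ i j x y eq = ∈-⊗⁺ (x∈⁅x⁆ x) (x∈⁅x⁆ y)

  ≗-combine : ∀ {s t : Subset (a * b)} →
              (∀ i j → lookup s (combine i j) ≡ lookup t (combine i j)) → s ≡ t
  ≗-combine h = ≡-combine λ i j →
    mk⇔ (λ c∈ → from ∈⇔lookup (trans (sym (h i j)) (to ∈⇔lookup c∈)))
        (λ c∈ → from ∈⇔lookup (trans (h i j) (to ∈⇔lookup c∈)))

  ∪-⊗ : ∀ (p q : Subset a) (r : Subset b) → (p ∪ q) ⊗ r ≡ p ⊗ r ∪ q ⊗ r
  ∪-⊗ p q r = ≗-combine λ i j → begin
    lookup ((p ∪ q) ⊗ r) (combine i j)                    ≡⟨ lookup-⊗ (p ∪ q) r i j ⟩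
    lookup (p ∪ q) i ∧ lookup r j                         ≡⟨ cong (_∧ lookup r j) (lookup-zipWith _∨_ i p q) ⟩
    (lookup p i ∨ lookup q i) ∧ lookup r j                ≡⟨ ∧-distribʳ-∨ (lookup r j) (lookup p i) (lookup q i) ⟩
    lookup p i ∧ lookup r j ∨ lookup q i ∧ lookup r j     ≡⟨ cong₂ _∨_ (lookup-⊗ p r i j) (lookup-⊗ q r i j) ⟨
    lookup (p ⊗ r) (combine i j) ∨ lookup (q ⊗ r) (combine i j)
                                                          ≡⟨ lookup-zipWith _∨_ (combine i j) (p ⊗ r) (q ⊗ r) ⟨
    lookup (p ⊗ r ∪ q ⊗ r) (combine i j)                  ∎
    where open ≡-Reasoning

  ⊗-∪ : ∀ (p : Subset a) (q r : Subset b) → p ⊗ (q ∪ r) ≡ p ⊗ q ∪ p ⊗ r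
  ⊗-∪ p q r = ≗-combine λ i j → begin
    lookup (p ⊗ (q ∪ r)) (combine i j)                    ≡⟨ lookup-⊗ p (q ∪ r) i j ⟩
    lookup p i ∧ lookup (q ∪ r) j                         ≡⟨ cong (lookup p i ∧_) (lookup-zipWith _∨_ j q r) ⟩
    lookup p i ∧ (lookup q j ∨ lookup r j)                ≡⟨ ∧-distribˡ-∨ (lookup p i) (lookup q j) (lookup r j) ⟩
    lookup p i ∧ lookup q j ∨ lookup p i ∧ lookup r j     ≡⟨ cong₂ _∨_ (lookup-⊗ p q i j) (lookup-⊗ p r i j) ⟨
    lookup (p ⊗ q) (combine i j) ∨ lookup (p ⊗ r) (combine i j)
                                                          ≡⟨ lookup-zipWith _∨_ (combine i j) (p ⊗ q) (p ⊗ r) ⟨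
    lookup (p ⊗ q ∪ p ⊗ r) (combine i j)                  ∎
    where open ≡-Reasoning

  ∈-⊗⁅⁆ : ∀ p y i j → combine i j ∈ p ⊗ ⁅ y ⁆ ⇔ (i ∈ p × j ≡ y)
  ∈-⊗⁅⁆ p y i j = mk⇔ (Data.Product.map₂ (x∈⁅y⁆⇒x≡y y) ∘ ∈-⊗⁻ p ⁅ y ⁆ i j)
                      (λ { (i∈p , refl) → ∈-⊗⁺ i∈p (x∈⁅x⁆ j) })

  ∈-⁅⁆⊗ : ∀ x q i j → combine i j ∈ ⁅ x ⁆ ⊗ q ⇔ (i ≡ x × j ∈ q)
  ∈-⁅⁆⊗ x q i j = mk⇔ (Data.Product.map₁ (x∈⁅y⁆⇒x≡y x) ∘ ∈-⊗⁻ ⁅ x ⁆ q i j)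
                      (λ { (refl , j∈q) → ∈-⊗⁺ (x∈⁅x⁆ i) j∈q })

  ∈-⊗⊤∪⊤⊗ : ∀ C A i j → combine i j ∈ C ⊗ ⊤ ∪ ⊤ {a} ⊗ A ⇔ (i ∈ C ⊎ j ∈ A)
  ∈-⊗⊤∪⊤⊗ C A i j = mk⇔
    (Data.Sum.map (proj₁ ∘ ∈-⊗⁻ C ⊤ i j) (proj₂ ∘ ∈-⊗⁻ ⊤ A i j) ∘ x∈p∪q⁻ (C ⊗ ⊤) (⊤ {a} ⊗ A))
    (x∈p∪q⁺ ∘ Data.Sum.map (λ i∈C → ∈-⊗⁺ i∈C ∈⊤) (∈-⊗⁺ ∈⊤))

  ⊗-cancelʳ : ∀ {p q : Subset a} {r : Subset b} {j} → j ∈ r → p ⊗ r ≡ q ⊗ r → p ≡ q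
  ⊗-cancelʳ {r = r} {j} j∈r eq = ⊆-antisym (⊆ eq) (⊆ (sym eq))
    where
    ⊆ : ∀ {p q} → p ⊗ r ≡ q ⊗ r → p ⊆ q
    ⊆ {q = q} eq {i} i∈p = proj₁ (∈-⊗⁻ q r i j (subst (combine i j ∈_) eq (∈-⊗⁺ i∈p j∈r)))

  ⊗-cancelˡ : ∀ {p : Subset a} {q r : Subset b} {i} → i ∈ p → p ⊗ q ≡ p ⊗ r → q ≡ r
  ⊗-cancelˡ {p} {i = i} i∈p eq = ⊆-antisym (⊆ eq) (⊆ (sym eq))
    where
    ⊆ : ∀ {q r} → p ⊗ q ≡ p ⊗ r → q ⊆ r
    ⊆ {r = r} eq {j} j∈q = proj₂ (∈-⊗⁻ p r i j (subst (combine i j ∈_) eq (∈-⊗⁺ i∈p j∈q)))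

-- The projection onto the first factor; row i of s occupies b consecutive positions.
shadow : ∀ a b → Subset (a * b) → Subset a
shadow zero    b s = []
shadow (suc a) b s = does (nonempty? (take b s)) ∷ shadow a b (drop b s)

∈-shadow : ∀ {a b} (s : Subset (a * b)) (i : Fin a) (j : Fin b) → combine i j ∈ s → i ∈ shadow a b s
∈-shadow {suc a} {b} s zero j c∈s with nonempty? (take b s)
... | yes _  = here
... | no  ¬p = ⊥-elim (¬p (j , from ∈⇔lookup (begin
  lookup (take b s) j                       ≡⟨ lookup-++ˡ (take b s) (drop b s) j ⟨
  lookup (take b s ++ drop b s) (j ↑ˡ _)    ≡⟨ cong (λ t → lookup t (j ↑ˡ _)) (take++drop≡id b s) ⟩
  lookup s (j ↑ˡ _)                         ≡⟨ to ∈⇔lookup c∈s ⟩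
  inside                                    ∎)))
  where open ≡-Reasoning
∈-shadow {suc a} {b} s (suc i) j c∈s = there (∈-shadow (drop b s) i j (from ∈⇔lookup (begin
  lookup (drop b s) (combine i j)                      ≡⟨ lookup-++ʳ (take b s) (drop b s) (combine i j) ⟨
  lookup (take b s ++ drop b s) (b ↑ʳ combine i j)     ≡⟨ cong (λ t → lookup t (b ↑ʳ combine i j)) (take++drop≡id b s) ⟩
  lookup s (b ↑ʳ combine i j)                          ≡⟨ to ∈⇔lookup c∈s ⟩
  inside                                               ∎)))
  where open ≡-Reasoning

∣shadow∣≤∣∣ : ∀ a b (s : Subset (a * b)) → ∣ shadow a b s ∣ ≤ ∣ s ∣
∣shadow∣≤∣∣ zero    b s = z≤n
∣shadow∣≤∣∣ (suc a) b s = begin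
  ∣ shadow (suc a) b s ∣                    ≤⟨ ∣nonempty?∷q∣ (take b s) (shadow a b (drop b s)) ⟩
  ∣ take b s ∣ + ∣ shadow a b (drop b s) ∣  ≤⟨ +-monoʳ-≤ ∣ take b s ∣ (∣shadow∣≤∣∣ a b (drop b s)) ⟩
  ∣ take b s ∣ + ∣ drop b s ∣               ≡⟨ ∣++∣ (take b s) (drop b s) ⟨
  ∣ take b s ++ drop b s ∣                  ≡⟨ cong ∣_∣ (take++drop≡id b s) ⟩
  ∣ s ∣                                     ∎
  where
  open ≤-Reasoning
  ∣nonempty?∷q∣ : ∀ {a b} (p : Subset a) (q : Subset b) → ∣ does (nonempty? p) ∷ q ∣ ≤ ∣ p ∣ + ∣ q ∣
  ∣nonempty?∷q∣ p q with nonempty? p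
  ... | yes p≢∅ = +-monoˡ-≤ ∣ q ∣ (Nonempty⇒0<∣p∣ p≢∅)
  ... | no  _   = m≤n+m ∣ q ∣ ∣ p ∣

Stalled : (d : ℕ) (G : Hypergraph) → Subset (n G) → Set
Stalled d G C = ∀ S w → ¬ Forces d G C S w

module _ {d : ℕ} {G : Hypergraph} where

  forces-⊆ : ∀ {P Q S w} → P ⊆ Q → w ∉ Q → Forces d G P S w → Forces d G Q S w
  forces-⊆ P⊆Q w∉Q (∣S∣ , _ , edge , unique) = ∣S∣ , w∉Q , edge , λ u u∉Q → unique u (u∉Q ∘ P⊆Q)

  reaches-trans : ∀ {A B C} → Reaches d G A B → Reaches d G B C → Reaches d G A C
  reaches-trans done         B→C = B→C
  reaches-trans (step S w F r) B→C = step S w F (reaches-trans r B→C)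

  reaches⇒⊆ : ∀ {B C} → Reaches d G B C → B ⊆ C
  reaches⇒⊆ done           = id
  reaches⇒⊆ (step S w F r) = reaches⇒⊆ r ∘ x∈p∪⁅y⁆⁺ ∘ inj₁

  reaches-mono : ∀ {B Y X} → Reaches d G B Y → B ⊆ X → ∃ λ Z → Reaches d G X Z × Y ⊆ Z
  reaches-mono {X = X} done B⊆X = X , done , B⊆X
  reaches-mono {X = X} (step S w F r) B⊆X with w ∈? X
  ... | yes w∈X = reaches-mono r ([ B⊆X , (λ { refl → w∈X }) ] ∘ x∈p∪⁅y⁆⁻)
  ... | no  w∉X with reaches-mono {X = X ∪ ⁅ w ⁆} r (x∈p∪⁅y⁆⁺ ∘ Data.Sum.map₁ B⊆X ∘ x∈p∪⁅y⁆⁻)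
  ...   | Z , X→Z , Y⊆Z = Z , step S w (forces-⊆ B⊆X w∉X F) X→Z , Y⊆Z

  zeroForcing-⊇ : ∀ {B X} → ZeroForcingSet d G B → B ⊆ X → ZeroForcingSet d G X
  zeroForcing-⊇ B→⊤ B⊆X with reaches-mono B→⊤ B⊆X
  ... | Z , X→Z , ⊤⊆Z = subst (Reaches d G _) (⊆-antisym ⊆⊤ ⊤⊆Z) X→Z

  reaches-cover : ∀ {P} (T : Subset (n G)) →
                  (∀ {Q} → P ⊆ Q → ∀ {c} → c ∈ T → ∃ λ R → Reaches d G Q R × c ∈ R) →
                  ∃ λ R → Reaches d G P R × T ⊆ R
  reaches-cover {P} T reach with go (allFin (n G)) ⊆-refl
    where
    go : ∀ (l : List (Fin (n G))) {Q} → P ⊆ Q →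
         ∃ λ R → Reaches d G Q R × (∀ {c} → c ∈ₗ l → c ∈ T → c ∈ R)
    go []      {Q} _   = Q , done , λ ()
    go (c ∷ l) {Q} P⊆Q with c ∈? T
    ... | no c∉T with go l P⊆Q
    ...   | R , Q→R , cover = R , Q→R , λ { (here refl) c∈T → ⊥-elim (c∉T c∈T) ; (there m) → cover m }
    go (c ∷ l) {Q} P⊆Q | yes c∈T with reach P⊆Q c∈T
    ...   | R₁ , Q→R₁ , c∈R₁ with go l (⊆-trans P⊆Q (reaches⇒⊆ Q→R₁))
    ...     | R₂ , R₁→R₂ , cover =
      R₂ , reaches-trans Q→R₁ R₁→R₂ , λ { (here refl) _ → reaches⇒⊆ R₁→R₂ c∈R₁ ; (there m) → cover m }
  ... | R , P→R , cover = R , P→R , cover (∈-allFin _)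

  zeroForcing-cover : ∀ {P} → (∀ {Q} → P ⊆ Q → ∀ c → ∃ λ R → Reaches d G Q R × c ∈ R) →
                      ZeroForcingSet d G P
  zeroForcing-cover reach with reaches-cover ⊤ (λ P⊆Q {c} _ → reach P⊆Q c)
  ... | R , P→R , ⊤⊆R = subst (Reaches d G _) (⊆-antisym ⊆⊤ ⊤⊆R) P→R

  stalled-invariant : ∀ {C P Q} → Stalled d G C → P ⊆ C → Reaches d G P Q → Q ⊆ C
  stalled-invariant stalled P⊆C done = P⊆C
  stalled-invariant {C} stalled P⊆C (step S w F r) with w ∈? C
  ... | yes w∈C = stalled-invariant stalled ([ P⊆C , (λ { refl → w∈C }) ] ∘ x∈p∪⁅y⁆⁻) r
  ... | no  w∉C = ⊥-elim (stalled S w (forces-⊆ P⊆C w∉C F))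

  -- E is not decidable, so a stalled closure exists only up to double negation.
  reaches-stalled : ∀ X → ¬ ¬ (∃ λ C → Reaches d G X C × Stalled d G C)
  reaches-stalled X ¬stalled = go (n G) done (m≤m+n (n G) ∣ X ∣)
    where
    go : ∀ fuel {C} → Reaches d G X C → n G ≤ fuel + ∣ C ∣ → ⊥
    go fuel {C} X→C bound = ¬stalled (C , X→C , stalled fuel bound)
      where
      stalled : ∀ f → n G ≤ f + ∣ C ∣ → Stalled d G C
      stalled zero    bound′ S w (_ , w∉C , _) =
        <⇒≱ (≤-<-trans bound′ (∣p∣<∣p∪⁅x⁆∣ w∉C)) (∣p∣≤n (C ∪ ⁅ w ⁆))
      stalled (suc f) bound′ S w F@(_ , w∉C , _) =
        go f (reaches-trans X→C (step S w F done)) (begin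
          n G                    ≤⟨ bound′ ⟩
          suc f + ∣ C ∣          ≡⟨ +-suc f ∣ C ∣ ⟨
          f + suc ∣ C ∣          ≤⟨ +-monoʳ-≤ f (∣p∣<∣p∪⁅x⁆∣ w∉C) ⟩
          f + ∣ C ∪ ⁅ w ⁆ ∣      ∎)
        where open ≤-Reasoning

  reached-misses : ∀ {X C} → ¬ ZeroForcingSet d G X → Reaches d G X C → ∃ λ x → x ∉ C
  reached-misses ¬X→⊤ X→C = ¬∀⟶∃¬ (n G) (_∈ _) (_∈? _)
    λ all → ¬X→⊤ (subst (Reaches d G _) (⊆-antisym ⊆⊤ (λ {x} _ → all x)) X→C)

-- A copy of G inside K, such as a layer V × {y} or a fiber {x} × V′ of H □ H′.
-- The field edge-through is where d ≥ 3 enters.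
record Slice (G K : Hypergraph) : Set where
  field
    point           : Fin (n G) → Fin (n K)
    point-injective : ∀ {i j} → point i ≡ point j → i ≡ j
    embed           : Subset (n G) → Subset (n K)
    ∣embed∣         : ∀ X → ∣ embed X ∣ ≡ ∣ X ∣
    embed-∪⁅⁆       : ∀ X i → embed (X ∪ ⁅ i ⁆) ≡ embed X ∪ ⁅ point i ⁆
    embed-restrict  : ∀ {S X} → S ⊆ embed X → embed (preimage point S) ≡ S
    embed-edge      : ∀ {X} → E G X → E K (embed X)
    edge-through    : ∀ {X c} → 2 ≤ ∣ X ∣ → E K (embed X ∪ ⁅ c ⁆) →
                      ∃ λ u → c ≡ point u × E G (X ∪ ⁅ u ⁆)

  restrict : Subset (n K) → Subset (n G)
  restrict = preimage point

  ∈-restrict : ∀ P i → i ∈ restrict P ⇔ point i ∈ P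
  ∈-restrict = ∈-preimage point

module _ {d : ℕ} {G K : Hypergraph} (σ : Slice G K) (2≤d∸1 : 2 ≤ d ∸ 1) where
  open Slice σ

  private
    2≤∣∣ : ∀ (T : Subset (n G)) → ∣ T ∣ ≡ d ∸ 1 → 2 ≤ ∣ T ∣
    2≤∣∣ T ∣T∣ = subst (2 ≤_) (sym ∣T∣) 2≤d∸1

  embed-forces : ∀ {P T x} → Forces d G (restrict P) T x → Forces d K P (embed T) (point x)
  embed-forces {P} {T} {x} (∣T∣ , x∉ , edge , unique) =
    trans (∣embed∣ T) ∣T∣ , x∉ ∘ from (∈-restrict P x) ,
    subst (E K) (embed-∪⁅⁆ T x) (embed-edge edge) , unique′
    where
    unique′ : ∀ c → c ∉ P → E K (embed T ∪ ⁅ c ⁆) → c ≡ point x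
    unique′ c c∉P edge′ with edge-through (2≤∣∣ T ∣T∣) edge′
    ... | u , refl , edgeᵤ = cong point (unique u (c∉P ∘ to (∈-restrict P u)) edgeᵤ)

  restrict-forces : ∀ {P T x} → Forces d K P (embed T) (point x) → Forces d G (restrict P) T x
  restrict-forces {P} {T} {x} (∣eT∣ , px∉P , edge , unique) =
    ∣T∣ , px∉P ∘ to (∈-restrict P x) , edgeₓ , unique′
    where
    ∣T∣ : ∣ T ∣ ≡ d ∸ 1
    ∣T∣ = trans (sym (∣embed∣ T)) ∣eT∣
    edgeₓ : E G (T ∪ ⁅ x ⁆)
    edgeₓ with edge-through (2≤∣∣ T ∣T∣) edge
    ... | u , px≡pu , edgeᵤ rewrite point-injective px≡pu = edgeᵤ
    unique′ : ∀ u → u ∉ restrict P → E G (T ∪ ⁅ u ⁆) → u ≡ x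
    unique′ u u∉ edgeᵤ = point-injective
      (unique (point u) (u∉ ∘ from (∈-restrict P u)) (subst (E K) (embed-∪⁅⁆ T u) (embed-edge edgeᵤ)))

  restrict-∪⁅⁆ : ∀ P w → restrict (P ∪ ⁅ point w ⁆) ≡ restrict P ∪ ⁅ w ⁆
  restrict-∪⁅⁆ P w = ⊆-antisym
    (λ {i} → x∈p∪⁅y⁆⁺ ∘ Data.Sum.map (from (∈-restrict P i)) point-injective
                      ∘ x∈p∪⁅y⁆⁻ ∘ to (∈-restrict _ i))
    (λ {i} → from (∈-restrict _ i) ∘ x∈p∪⁅y⁆⁺
           ∘ Data.Sum.map (to (∈-restrict P i)) (cong point) ∘ x∈p∪⁅y⁆⁻)

  simulate : ∀ {X Y} → Reaches d G X Y → ∀ {P} → restrict P ≡ X →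
             ∃ λ Q → Reaches d K P Q × (∀ {i} → i ∈ Y → point i ∈ Q)
  simulate done           {P} refl = P , done , λ {i} → to (∈-restrict P i)
  simulate (step T w F r) {P} refl with simulate r (restrict-∪⁅⁆ P w)
  ... | Q , P′→Q , cover = Q , step (embed T) (point w) (embed-forces F) P′→Q , cover

  fill-slice : ∀ {X P} → ZeroForcingSet d G X → X ⊆ restrict P →
               ∃ λ Q → Reaches d K P Q × (∀ i → point i ∈ Q)
  fill-slice X→⊤ X⊆ with simulate (zeroForcing-⊇ X→⊤ X⊆) refl
  ... | Q , P→Q , cover = Q , P→Q , λ i → cover ∈⊤

  stalled-slice : ∀ {C W S X x} → restrict W ⊆ C → x ∉ C → Stalled d G C → S ⊆ embed X →
                  ¬ Forces d K W S (point x)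
  stalled-slice {W = W} {S} {x = x} W⊆C x∉C stalled S⊆ F = stalled _ _
    (forces-⊆ {d = d} {G = G} W⊆C x∉C (restrict-forces (subst (λ T → Forces d K W T (point x)) S≡ F)))
    where
    S≡ : S ≡ embed (restrict S)
    S≡ = sym (embed-restrict S⊆)

module Product (d : ℕ) (2≤d∸1 : 2 ≤ d ∸ 1) (H H′ : Hypergraph) where
  open Grid (n H) (n H′)

  private
    PH = H □ H′
    V  = ⊤ {n H}
    V′ = ⊤ {n H′}

  edge-at : ∀ {s x y} → E PH s → combine x y ∈ s →
            (∃ λ e → E H e × s ≡ e ⊗ ⁅ y ⁆) ⊎ (∃ λ e′ → E H′ e′ × s ≡ ⁅ x ⁆ ⊗ e′)
  edge-at {s} {x} {y} (inj₁ (e , y′ , edge , ∈s⇔)) xy∈s with proj₂ (to (∈s⇔ x y) xy∈s)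
  ... | refl = inj₁ (e , edge , ≡-combine λ i j → mk⇔ (from (∈-⊗⁅⁆ e y i j) ∘ to (∈s⇔ i j))
                                                      (from (∈s⇔ i j) ∘ to (∈-⊗⁅⁆ e y i j)))
  edge-at {s} {x} {y} (inj₂ (x′ , e′ , edge , ∈s⇔)) xy∈s with proj₁ (to (∈s⇔ x y) xy∈s)
  ... | refl = inj₂ (e′ , edge , ≡-combine λ i j → mk⇔ (from (∈-⁅⁆⊗ x e′ i j) ∘ to (∈s⇔ i j))
                                                       (from (∈s⇔ i j) ∘ to (∈-⁅⁆⊗ x e′ i j)))

  layer : Fin (n H′) → Slice H PH
  layer y = record
    { point           = λ i → combine i y
    ; point-injective = λ {i} {j} → combine-injectiveˡ i y j y
    ; embed           = _⊗ ⁅ y ⁆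
    ; ∣embed∣         = λ X →
        trans (∣⊗∣ X ⁅ y ⁆) (trans (cong (∣ X ∣ *_) (∣⁅x⁆∣≡1 y)) (*-identityʳ ∣ X ∣))
    ; embed-∪⁅⁆       = ∪⁅⁆-⊗⁅⁆
    ; embed-restrict  = λ {S} {X} → restrict-⊗⁅⁆ {S} {X}
    ; embed-edge      = λ {X} edge → inj₁ (X , y , edge , ∈-⊗⁅⁆ X y)
    ; edge-through    = λ {X} → edge-through {X}
    }
    where
    ∪⁅⁆-⊗⁅⁆ : ∀ X i → (X ∪ ⁅ i ⁆) ⊗ ⁅ y ⁆ ≡ X ⊗ ⁅ y ⁆ ∪ ⁅ combine i y ⁆
    ∪⁅⁆-⊗⁅⁆ X i = trans (∪-⊗ X ⁅ i ⁆ ⁅ y ⁆) (cong (X ⊗ ⁅ y ⁆ ∪_) (⁅⁆⊗⁅⁆ i y))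

    restrict-⊗⁅⁆ : ∀ {S X} → S ⊆ X ⊗ ⁅ y ⁆ →
                   preimage (λ (i : Fin (n H)) → combine i y) S ⊗ ⁅ y ⁆ ≡ S
    restrict-⊗⁅⁆ {S} {X} S⊆ = ≡-combine λ i j → mk⇔
      (λ ij∈ → case to (∈-⊗⁅⁆ R y i j) ij∈ of λ { (i∈ , refl) → to (∈-preimage row S i) i∈ })
      (λ ij∈ → case to (∈-⊗⁅⁆ X y i j) (S⊆ ij∈) of λ
        { (_ , refl) → from (∈-⊗⁅⁆ R y i j) (from (∈-preimage row S i) ij∈ , refl) })
      where
      row = λ (k : Fin (n H)) → combine k y
      R = preimage row S

    edge-through : ∀ {X c} → 2 ≤ ∣ X ∣ → E PH (X ⊗ ⁅ y ⁆ ∪ ⁅ c ⁆) →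
                   ∃ λ u → c ≡ combine u y × E H (X ∪ ⁅ u ⁆)
    edge-through {X} {c} 2≤∣X∣ edge
      with 0<∣p∣⇒Nonempty {p = X} (≤-trans (s≤s z≤n) 2≤∣X∣) | combine-surjective c
    ... | i , i∈X | a , b , refl with edge-at edge (x∈p∪q⁺ (inj₁ (∈-⊗⁺ i∈X (x∈⁅x⁆ y))))
    ... | inj₂ (e′ , _ , eq) = ⊥-elim (<⇒≱ 2≤∣X∣ (p⊆⁅x⁆⇒∣p∣≤1 X⊆⁅i⁆))
      where
      X⊆⁅i⁆ : X ⊆ ⁅ i ⁆
      X⊆⁅i⁆ {k} k∈X with to (∈-⁅⁆⊗ i e′ k y) (subst (combine k y ∈_) eq (x∈p∪q⁺ (inj₁ (∈-⊗⁺ k∈X (x∈⁅x⁆ y)))))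
      ... | refl , _ = x∈⁅x⁆ i
    ... | inj₁ (e , edgeₑ , eq) with to (∈-⊗⁅⁆ e y a b) (subst (combine a b ∈_) eq (x∈p∪⁅y⁆⁺ (inj₂ refl)))
    ...   | _ , refl = a , refl , subst (E H) e≡X∪⁅a⁆ edgeₑ
      where
      e≡X∪⁅a⁆ : e ≡ X ∪ ⁅ a ⁆
      e≡X∪⁅a⁆ = ⊗-cancelʳ (x∈⁅x⁆ y) (trans (sym eq) (sym (∪⁅⁆-⊗⁅⁆ X a)))

  fiber : Fin (n H) → Slice H′ PH
  fiber x = record
    { point           = λ j → combine x j
    ; point-injective = λ {i} {j} → combine-injectiveʳ x i x j
    ; embed           = ⁅ x ⁆ ⊗_
    ; ∣embed∣         = λ Y →
        trans (∣⊗∣ ⁅ x ⁆ Y) (trans (cong (_* ∣ Y ∣) (∣⁅x⁆∣≡1 x)) (+-identityʳ ∣ Y ∣))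
    ; embed-∪⁅⁆       = ⁅⁆⊗-∪⁅⁆
    ; embed-restrict  = λ {S} {Y} → restrict-⁅⁆⊗ {S} {Y}
    ; embed-edge      = λ {Y} edge → inj₂ (x , Y , edge , ∈-⁅⁆⊗ x Y)
    ; edge-through    = λ {X} → edge-through {X}
    }
    where
    ⁅⁆⊗-∪⁅⁆ : ∀ Y j → ⁅ x ⁆ ⊗ (Y ∪ ⁅ j ⁆) ≡ ⁅ x ⁆ ⊗ Y ∪ ⁅ combine x j ⁆
    ⁅⁆⊗-∪⁅⁆ Y j = trans (⊗-∪ ⁅ x ⁆ Y ⁅ j ⁆) (cong (⁅ x ⁆ ⊗ Y ∪_) (⁅⁆⊗⁅⁆ x j))

    restrict-⁅⁆⊗ : ∀ {S Y} → S ⊆ ⁅ x ⁆ ⊗ Y → ⁅ x ⁆ ⊗ preimage (combine x) S ≡ S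
    restrict-⁅⁆⊗ {S} {Y} S⊆ = ≡-combine λ i j → mk⇔
      (λ ij∈ → case to (∈-⁅⁆⊗ x R i j) ij∈ of λ { (refl , j∈) → to (∈-preimage (combine x) S j) j∈ })
      (λ ij∈ → case to (∈-⁅⁆⊗ x Y i j) (S⊆ ij∈) of λ
        { (refl , _) → from (∈-⁅⁆⊗ x R i j) (refl , from (∈-preimage (combine x) S j) ij∈) })
      where
      R = preimage (combine x) S

    edge-through : ∀ {Y c} → 2 ≤ ∣ Y ∣ → E PH (⁅ x ⁆ ⊗ Y ∪ ⁅ c ⁆) →
                   ∃ λ u → c ≡ combine x u × E H′ (Y ∪ ⁅ u ⁆)
    edge-through {Y} {c} 2≤∣Y∣ edge
      with 0<∣p∣⇒Nonempty {p = Y} (≤-trans (s≤s z≤n) 2≤∣Y∣) | combine-surjective c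
    ... | j , j∈Y | a , b , refl with edge-at edge (x∈p∪q⁺ (inj₁ (∈-⊗⁺ (x∈⁅x⁆ x) j∈Y)))
    ... | inj₁ (e , _ , eq) = ⊥-elim (<⇒≱ 2≤∣Y∣ (p⊆⁅x⁆⇒∣p∣≤1 Y⊆⁅j⁆))
      where
      Y⊆⁅j⁆ : Y ⊆ ⁅ j ⁆
      Y⊆⁅j⁆ {k} k∈Y with to (∈-⊗⁅⁆ e j x k) (subst (combine x k ∈_) eq (x∈p∪q⁺ (inj₁ (∈-⊗⁺ (x∈⁅x⁆ x) k∈Y))))
      ... | _ , refl = x∈⁅x⁆ j
    ... | inj₂ (e′ , edgeₑ , eq) with to (∈-⁅⁆⊗ x e′ a b) (subst (combine a b ∈_) eq (x∈p∪⁅y⁆⁺ (inj₂ refl)))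
    ...   | refl , _ = b , refl , subst (E H′) e′≡Y∪⁅b⁆ edgeₑ
      where
      e′≡Y∪⁅b⁆ : e′ ≡ Y ∪ ⁅ b ⁆
      e′≡Y∪⁅b⁆ = ⊗-cancelˡ (x∈⁅x⁆ x) (trans (sym eq) (sym (⁅⁆⊗-∪⁅⁆ Y b)))

  stalled-□ : ∀ {C A} → Stalled d H C → Stalled d H′ A → Stalled d PH (C ⊗ V′ ∪ V ⊗ A)
  stalled-□ {C} {A} stalledC stalledA S c F@(_ , c∉W , edge , _) with combine-surjective c
  ... | x , y , refl = case edge-at edge (x∈p∪⁅y⁆⁺ (inj₂ refl)) of λ
    { (inj₁ (e , _ , eq)) → stalled-slice {d} (layer y) 2≤d∸1 {X = e}
        (λ {i} → [ id , ⊥-elim ∘ y∉A ] ∘ to (∈-⊗⊤∪⊤⊗ C A i y) ∘ to (Slice.∈-restrict (layer y) _ i))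
        x∉C stalledC (p∪q≡r⇒p⊆r eq) F
    ; (inj₂ (e′ , _ , eq)) → stalled-slice {d} (fiber x) 2≤d∸1 {X = e′}
        (λ {j} → [ ⊥-elim ∘ x∉C , id ] ∘ to (∈-⊗⊤∪⊤⊗ C A x j) ∘ to (Slice.∈-restrict (fiber x) _ j))
        y∉A stalledA (p∪q≡r⇒p⊆r eq) F
    }
    where
    x∉C : x ∉ C
    x∉C = c∉W ∘ from (∈-⊗⊤∪⊤⊗ C A x y) ∘ inj₁
    y∉A : y ∉ A
    y∉A = c∉W ∘ from (∈-⊗⊤∪⊤⊗ C A x y) ∘ inj₂

  fill-layers : ∀ {B B′} → ZeroForcingSet d H B →
                ∃ λ Q → Reaches d PH (B ⊗ B′) Q × V ⊗ B′ ⊆ Q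
  fill-layers {B} {B′} B→⊤ = reaches-cover (V ⊗ B′) fill
    where
    fill : ∀ {Q} → B ⊗ B′ ⊆ Q → ∀ {c} → c ∈ V ⊗ B′ → ∃ λ R → Reaches d PH Q R × c ∈ R
    fill {Q} B⊗B′⊆Q {c} c∈ with combine-surjective c
    ... | i , j , refl with fill-slice (layer j) 2≤d∸1 B→⊤ B⊆
      where
      B⊆ : B ⊆ Slice.restrict (layer j) Q
      B⊆ {k} k∈B = from (Slice.∈-restrict (layer j) Q k)
                        (B⊗B′⊆Q (∈-⊗⁺ k∈B (proj₂ (∈-⊗⁻ V B′ i j c∈))))
    ... | R , Q→R , full = R , Q→R , full i

  fill-fibers : ∀ {B′ Q} → ZeroForcingSet d H′ B′ → V ⊗ B′ ⊆ Q → ZeroForcingSet d PH Q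
  fill-fibers {B′} {Q} B′→⊤ V⊗B′⊆Q = zeroForcing-cover fill
    where
    fill : ∀ {R} → Q ⊆ R → ∀ c → ∃ λ S → Reaches d PH R S × c ∈ S
    fill {R} Q⊆R c with combine-surjective c
    ... | i , j , refl with fill-slice (fiber i) 2≤d∸1 B′→⊤ B′⊆
      where
      B′⊆ : B′ ⊆ Slice.restrict (fiber i) R
      B′⊆ {k} k∈B′ = from (Slice.∈-restrict (fiber i) R k) (Q⊆R (V⊗B′⊆Q (∈-⊗⁺ ∈⊤ k∈B′)))
    ... | S , R→S , full = S , R→S , full j

  ⊗-zeroForcing : ∀ {B B′} → ZeroForcingSet d H B → ZeroForcingSet d H′ B′ →
                  ZeroForcingSet d PH (B ⊗ B′)
  ⊗-zeroForcing {B′ = B′} B→⊤ B′→⊤ with fill-layers {B′ = B′} B→⊤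
  ... | Q , B⊗B′→Q , V⊗B′⊆Q = reaches-trans B⊗B′→Q (fill-fibers B′→⊤ V⊗B′⊆Q)

  zeroForcing-□-≥ : ∀ {k B} → (∀ D → ZeroForcingSet d H D → k ≤ ∣ D ∣) → ¬ ZeroForcingSet d H′ ∅ →
                    ZeroForcingSet d PH B → k ≤ ∣ B ∣
  zeroForcing-□-≥ {k} {B} minimal ¬∅→⊤ B→⊤ = decidable-stable (k ≤? ∣ B ∣) λ k≰∣B∣ →
    reaches-stalled {d = d} {G = H} D λ { (C , D→C , stalledC) →
    reaches-stalled {d = d} {G = H′} ∅ λ { (A , ∅→A , stalledA) →
      let x , x∉C = reached-misses (¬D→⊤ k≰∣B∣) D→C
          y , y∉A = reached-misses ¬∅→⊤ ∅→A
          B⊆W     = ⊆-combine λ i j ij∈B →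
                      from (∈-⊗⊤∪⊤⊗ C A i j) (inj₁ (reaches⇒⊆ D→C (∈-shadow B i j ij∈B)))
          ⊤⊆W     = stalled-invariant (stalled-□ stalledC stalledA) B⊆W B→⊤
      in [ x∉C , y∉A ] (to (∈-⊗⊤∪⊤⊗ C A x y) (⊤⊆W ∈⊤)) } }
    where
    D = shadow (n H) (n H′) B
    ¬D→⊤ : ¬ k ≤ ∣ B ∣ → ¬ ZeroForcingSet d H D
    ¬D→⊤ k≰∣B∣ D→⊤ = k≰∣B∣ (≤-trans (minimal D D→⊤) (∣shadow∣≤∣∣ (n H) (n H′) B))

theorem3p23 : (d : ℕ) → 3 ≤ d → (H H' : Hypergraph) →
              Uniform d H → Uniform d H' → IsZ₀ d H' 1 →
              (k : ℕ) → IsZ₀ d H k → IsZ₀ d (H □ H') k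
theorem3p23 d 3≤d H H′ _ _ ((B′ , B′→⊤ , ∣B′∣≡1) , minimal′) k ((B , B→⊤ , ∣B∣≡k) , minimal) =
  (B ⊗ B′ , ⊗-zeroForcing B→⊤ B′→⊤ , ∣B⊗B′∣≡k) , λ _ → zeroForcing-□-≥ minimal ¬∅→⊤
  where
  open Product d (∸-monoˡ-≤ 1 3≤d) H H′

  ∣B⊗B′∣≡k : ∣ B ⊗ B′ ∣ ≡ k
  ∣B⊗B′∣≡k = begin
    ∣ B ⊗ B′ ∣       ≡⟨ ∣⊗∣ B B′ ⟩
    ∣ B ∣ * ∣ B′ ∣   ≡⟨ cong₂ _*_ ∣B∣≡k ∣B′∣≡1 ⟩
    k * 1            ≡⟨ *-identityʳ k ⟩
    k                ∎
    where open ≡-Reasoning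

  ¬∅→⊤ : ¬ ZeroForcingSet d H′ ∅
  ¬∅→⊤ ∅→⊤ = 1+n≰n (subst (1 ≤_) (∣⊥∣≡0 (n H′)) (minimal′ ∅ ∅→⊤))
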